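{- Let $k$ be a prime number and $m$ a positive integer, and let $e_k(m)$ be the number of partial orders on $\{1,\dots,m+k\}$ whose set of minimal elements is exactly $\{1,\dots,m\}$. Then $e_k(m)-2^{mk}-(-1)^k$ is divisible by $k$. -}

module Defs where

open import Data.Bool using (Bool; true; false; T; T?)
open import Data.Nat using (ℕ; zero; suc; _<_; _<?_)
open import Data.Fin using (Fin; zero; suc; toℕ; _≟_)
open import Data.Fin.Properties using (all?)
open import Data.List using (List; []; _∷_; map; concatMap; filter; length)
open import Data.Product using (_×_; _,_)
open import Relation.Nullary using (Dec; yes; no)
open import Relation.Nullary.Decidable using (_×-dec_; _→-dec_; map′)
open import Relation.Binary.PropositionalEquality using (_≡_)

-- A binary relation on {0,…,n-1} (standing for {1,…,n}), given by its
-- characteristic function: i ≤ j  iff  T (R i j).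
BRel : ℕ → Set
BRel n = Fin n → Fin n → Bool

Refl : ∀ {n} → BRel n → Set
Refl {n} R = ∀ (i : Fin n) → T (R i i)

Antisym : ∀ {n} → BRel n → Set
Antisym {n} R = ∀ (i j : Fin n) → T (R i j) → T (R j i) → i ≡ j

Trans : ∀ {n} → BRel n → Set
Trans {n} R = ∀ (i j k : Fin n) → T (R i j) → T (R j k) → T (R i k)

IsPartialOrder : ∀ {n} → BRel n → Set
IsPartialOrder R = Refl R × Antisym R × Trans R

IsMinimal : ∀ {n} → BRel n → Fin n → Set
IsMinimal {n} R i = ∀ (j : Fin n) → T (R j i) → j ≡ i

MinimalsExactly : ∀ {n} → ℕ → BRel n → Set
MinimalsExactly {n} m R =
  ∀ (i : Fin n) → (IsMinimal R i → toℕ i < m) × (toℕ i < m → IsMinimal R i)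

Good : ∀ {n} → ℕ → BRel n → Set
Good m R = IsPartialOrder R × MinimalsExactly m R

good? : ∀ {n} (m : ℕ) (R : BRel n) → Dec (Good m R)
good? {n} m R =
  ((all? λ i → T? (R i i))
   ×-dec ((all? λ i → all? λ j → T? (R i j) →-dec (T? (R j i) →-dec (i ≟ j)))
   ×-dec (all? λ i → all? λ j → all? λ k →
            T? (R i j) →-dec (T? (R j k) →-dec T? (R i k)))))
  ×-dec (all? λ i → (min? i →-dec (toℕ i <? m)) ×-dec ((toℕ i <? m) →-dec min? i))
  where
  min? : (i : Fin n) → Dec (IsMinimal R i)
  min? i = all? λ j → T? (R j i) →-dec (j ≟ i)

allFuns : ∀ {A : Set} (n : ℕ) → List A → List (Fin n → A)
allFuns zero    xs = (λ ()) ∷ []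
allFuns (suc n) xs =
  concatMap (λ a → map (λ f → cons a f) (allFuns n xs)) xs
  where
  cons : ∀ {A : Set} {n} → A → (Fin n → A) → Fin (suc n) → A
  cons a f zero    = a
  cons a f (suc i) = f i

allRels : (n : ℕ) → List (BRel n)
allRels n = allFuns n (allFuns n (true ∷ false ∷ []))

e : ℕ → ℕ → ℕ
e k m = length (filter (good? m) (allRels (m Data.Nat.+ k)))

-- Let σ fix the points 1, …, m and cycle the points m+1, …, m+k.  Conjugation by σ is an
-- action of ℤ/k on relations preserving the posets counted by e_k(m); for prime k every orbit
-- has 1 or k elements, so e_k(m) is congruent mod k to the number of σ-invariant such posets.
-- In an invariant poset the top points form an antichain (x ≤ σᵈ x forces σᵈ x ≤ x), the
-- bottom points are minimal, and the order is determined by the nonempty set of bottom points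
-- lying below the top: there are 2^m − 1 of them.  The same orbit count for rotations of
-- words of length k gives Fermat's 2^{mk} ≡ 2^m, and (−1)^k ≡ −1 (mod k) for prime k.

module Submission where

open import Defs
open import Level using (0ℓ)
open import Data.Bool using (Bool; true; false; T; T?; _∨_)
import Data.Bool.Properties as Bool
open import Data.Empty using (⊥-elim)
open import Data.Fin using (Fin; zero; suc; toℕ; fromℕ<; _↑ˡ_; _↑ʳ_; splitAt; join)
open import Data.Fin.Properties as Finₚ using (toℕ-fromℕ<; toℕ-injective; toℕ<n)
open import Data.Integer as ℤ using (+_; -_; _-_; _^_)
import Data.Integer.Properties as ℤ
import Data.Integer.Divisibility.Signed as ℤ
open import Data.Integer.Divisibility using (_∣_)
open import Data.Integer.Tactic.RingSolver using (solve-∀)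
open import Data.List using (List; []; _∷_; map; concatMap; filter; length; applyUpTo; allFin)
open import Data.List.Properties using (length-++; length-map; length-applyUpTo; length-tabulate; filter-notAll)
open import Data.List.Relation.Unary.Any as Any using (here; there)
open import Data.List.Relation.Unary.All using ([]; _∷_)
open import Data.List.Relation.Unary.AllPairs using ([]; _∷_)
import Data.List.Membership.Setoid as Membership
import Data.List.Membership.DecSetoid as DecMembership
open import Data.List.Membership.Setoid.Properties
  using (∈-resp-≈; ∉-resp-≈; ∈-filter⁺; ∈-filter⁻; ∈-map⁺; ∈-map⁻; ∈-concatMap⁺; ∈-concatMap⁻;
         ∈-applyUpTo⁺; ∈-applyUpTo⁻; All[≉]⇒∉)
open import Data.List.Membership.Propositional.Properties using (∈-allFin)
import Data.List.Relation.Binary.Subset.Setoid as Subset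
import Data.List.Relation.Unary.Unique.Setoid as UniqueS
import Data.List.Relation.Unary.Unique.Setoid.Properties as Unique
open import Data.List.Relation.Unary.Unique.Propositional.Properties using (allFin⁺)
import Data.Nat as ℕ
open import Data.Nat using (ℕ; zero; suc; _+_; _*_; _∸_; _≤_; _<_; z≤n; NonZero; >-nonZero; >-nonZero⁻¹; _%_; _/_)
open import Data.Nat.Properties
  using (+-suc; +-comm; +-identityʳ; *-comm; *-identityʳ; ^-*-assoc; suc-pred; ≤-antisym; ≤-trans; ≤-reflexive;
         <⇒≤; <⇒≱; m≤m+n; m<n+m; m<n⇒0<n∸m; +-monoʳ-<; m∸n+n≡m; m+[n∸m]≡n; +-commutativeSemigroup; module ≤-Reasoning)
open import Algebra.Properties.CommutativeSemigroup +-commutativeSemigroup using (x∙yz≈y∙xz; x∙yz≈xz∙y)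
open import Data.Nat.DivMod using (_mod_; m≡m%n+[m/n]*n; m%n<n; %-distribˡ-+; m%n%n≡m%n; m<n⇒m%n≡m; [m+n]%n≡m%n)
import Data.Nat.Divisibility as ℕ
open import Data.Nat.Primality using (Prime; prime⇒nonZero; prime⇒irreducible)
open import Data.Nat.Coprimality using (prime⇒coprime; coprime-Bézout)
open import Data.Nat.GCD using (module Bézout)
open import Data.Nat.Induction using (<-wellFounded)
open import Data.Product using (∃; _,_; proj₁; proj₂)
open import Data.Sum using (_⊎_; inj₁; inj₂)
import Data.Sum as Sum
open import Data.Vec.Functional as Vector using (Vector; tail)
import Data.Vec.Functional.Relation.Binary.Equality.Setoid as VecEquality
import Data.Vec.Functional.Relation.Binary.Pointwise.Properties as Pointwise
open import Data.Unit using (tt)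
open import Function using (_∘_; _on_; id; const; _⇔_; Equivalence; mk⇔)
open import Induction.WellFounded using (Acc; acc)
open import Relation.Binary.Bundles using (Setoid; DecSetoid)
import Relation.Binary.Construct.On as On
open import Relation.Binary.PropositionalEquality as ≡
  using (_≡_; _≢_; _≗_; refl; cong; cong₂; sym; trans; subst; subst₂; module ≡-Reasoning)
import Relation.Binary.Reasoning.Setoid as SetoidReasoning
open import Relation.Nullary using (Dec; ¬_; ¬?; does; yes; no)
open import Relation.Nullary.Decidable using (dec-true; dec-false)
open import Relation.Unary using (Pred; Decidable)
open import Relation.Unary.Properties using (∁?)

module _ {A : Set} {P : Pred A 0ℓ} (P? : Decidable P) where

  length-filter+filter-∁ : ∀ xs → length (filter P? xs) + length (filter (∁? P?) xs) ≡ length xs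
  length-filter+filter-∁ [] = refl
  length-filter+filter-∁ (x ∷ xs) with P? x
  ... | yes _ = cong suc (length-filter+filter-∁ xs)
  ... | no _ = trans (+-suc _ _) (cong suc (length-filter+filter-∁ xs))

module UniqueLength (S : DecSetoid 0ℓ 0ℓ) where
  open DecSetoid S using (_≈_; _≟_; setoid) renaming (refl to ≈-refl; sym to ≈-sym; trans to ≈-trans)
  open Membership setoid using (_∈_)
  open Subset setoid using (_⊆_)
  open UniqueS setoid using (Unique; []; _∷_)

  unique∧⊆⇒length≤ : ∀ {xs ys} → Unique xs → xs ⊆ ys → length xs ≤ length ys
  unique∧⊆⇒length≤ [] _ = z≤n
  unique∧⊆⇒length≤ {x ∷ xs} {ys} (x≉xs ∷ xs!) x∷xs⊆ys = begin-strict
    length xs                  ≤⟨ unique∧⊆⇒length≤ xs! xs⊆ys-x ⟩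
    length (filter (x ≉?_) ys) <⟨ filter-notAll (x ≉?_) ys x∈ys ⟩
    length ys                  ∎
    where
    open ≤-Reasoning
    _≉?_ : ∀ u v → Dec (¬ u ≈ v)
    u ≉? v = ¬? (u ≟ v)
    x∈ys : Any.Any (λ y → ¬ ¬ x ≈ y) ys
    x∈ys = Any.map (λ x≈y x≉y → x≉y x≈y) (x∷xs⊆ys (here ≈-refl))
    xs⊆ys-x : xs ⊆ filter (x ≉?_) ys
    xs⊆ys-x z∈xs = ∈-filter⁺ setoid (x ≉?_) (λ y≈z x≉y x≈z → x≉y (≈-trans x≈z (≈-sym y≈z)))
      (x∷xs⊆ys (there z∈xs)) (λ x≈z → All[≉]⇒∉ setoid x≉xs (∈-resp-≈ setoid (≈-sym x≈z) z∈xs))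

  unique∧⊆∧⊇⇒length≡ : ∀ {xs ys} → Unique xs → Unique ys → xs ⊆ ys → ys ⊆ xs → length xs ≡ length ys
  unique∧⊆∧⊇⇒length≡ xs! ys! xs⊆ys ys⊆xs =
    ≤-antisym (unique∧⊆⇒length≤ xs! xs⊆ys) (unique∧⊆⇒length≤ ys! ys⊆xs)

  module _ (T : Setoid 0ℓ 0ℓ) where
    open Setoid T using () renaming (_≈_ to _≈ᵀ_)

    length≡length-map : ∀ {f} → (∀ {x y} → f x ≈ f y → x ≈ᵀ y) → ∀ {xs ys} →
                        Unique xs → UniqueS.Unique T ys → xs ⊆ map f ys → map f ys ⊆ xs →
                        length xs ≡ length ys
    length≡length-map {f} f-injective {ys = ys} xs! ys! xs⊆f[ys] f[ys]⊆xs = trans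
      (unique∧⊆∧⊇⇒length≡ xs! (Unique.map⁺ T setoid f-injective ys!) xs⊆f[ys] f[ys]⊆xs)
      (length-map f ys)

module FunctionEnumeration (B : Setoid 0ℓ 0ℓ) where
  open Setoid B using (_≈_) renaming (Carrier to A; refl to ≈-refl; sym to ≈-sym)
  open Membership B using (_∈_)
  open UniqueS B using () renaming (Unique to UniqueB)
  open VecEquality B using (_≋_; ≋-setoid)

  module _ {n : ℕ} where
    open Membership (≋-setoid n) public using () renaming (_∈_ to _∈ᵛ_)
    open UniqueS (≋-setoid n) public using () renaming (Unique to Uniqueᵛ)

  -- allFuns conses with a function local to Defs; c stands for it, known only pointwise.
  module Prepend {n : ℕ} (c : A → Vector A n → Vector A (suc n)) (c≗∷ : ∀ a f → c a f ≗ a Vector.∷ f)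
                 (fs : List (Vector A n)) where

    prepend : List A → List (Vector A (suc n))
    prepend = concatMap (λ a → map (c a) fs)

    length-prepend : ∀ as → length (prepend as) ≡ length as * length fs
    length-prepend [] = refl
    length-prepend (a ∷ as) = trans (length-++ (map (c a) fs))
      (cong₂ _+_ (length-map (c a) fs) (length-prepend as))

    c-cong : ∀ a {f g} → f ≋ g → c a f ≋ c a g
    c-cong a {f} {g} f≋g zero = subst₂ _≈_ (sym (c≗∷ a f zero)) (sym (c≗∷ a g zero)) ≈-refl
    c-cong a {f} {g} f≋g (suc i) = subst₂ _≈_ (sym (c≗∷ a f (suc i))) (sym (c≗∷ a g (suc i))) (f≋g i)

    c-injective : ∀ a {f g} → c a f ≋ c a g → f ≋ g
    c-injective a {f} {g} c≋c i = subst₂ _≈_ (c≗∷ a f (suc i)) (c≗∷ a g (suc i)) (c≋c (suc i))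

    head≈ : ∀ {a f} → f ∈ᵛ map (c a) fs → f zero ≈ a
    head≈ {a} f∈ with ∈-map⁻ (≋-setoid _) (≋-setoid _) f∈
    ... | g , _ , f≋c[a,g] = subst (_ ≈_) (c≗∷ a g zero) (f≋c[a,g] zero)

    head∈ : ∀ {as f} → f ∈ᵛ prepend as → f zero ∈ as
    head∈ f∈ = Any.map head≈ (∈-concatMap⁻ B (≋-setoid _) f∈)

    prepend⁺ : Uniqueᵛ fs → ∀ {as} → UniqueB as → Uniqueᵛ (prepend as)
    prepend⁺ fs! [] = []
    prepend⁺ fs! {a ∷ as} (a≉as ∷ as!) =
      Unique.++⁺ (≋-setoid _) (Unique.map⁺ (≋-setoid _) (≋-setoid _) (c-injective a) fs!) (prepend⁺ fs! as!)
        λ (f∈map , f∈rest) → All[≉]⇒∉ B a≉as (∈-resp-≈ B (head≈ f∈map) (head∈ f∈rest))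

    ∈-prepend : ∀ {as} f → f zero ∈ as → tail f ∈ᵛ fs → f ∈ᵛ prepend as
    ∈-prepend f f₀∈as f′∈fs = ∈-concatMap⁺ B (≋-setoid _) (Any.map f∈map f₀∈as)
      where
      f∈map : ∀ {a} → f zero ≈ a → f ∈ᵛ map (c a) fs
      f∈map {a} f₀≈a = ∈-resp-≈ (≋-setoid _) c[a,f′]≋f (∈-map⁺ (≋-setoid _) (≋-setoid _) (c-cong a) f′∈fs)
        where
        c[a,f′]≋f : c a (tail f) ≋ f
        c[a,f′]≋f zero rewrite c≗∷ a (tail f) zero = ≈-sym f₀≈a
        c[a,f′]≋f (suc i) rewrite c≗∷ a (tail f) (suc i) = ≈-refl

  allFuns-complete : ∀ {as} → (∀ b → b ∈ as) → ∀ n f → f ∈ᵛ allFuns n as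
  allFuns-complete as-complete zero f = here (λ ())
  allFuns-complete {as} as-complete (suc n) f =
    Prepend.∈-prepend _ (λ a g → λ { zero → refl ; (suc i) → refl }) (allFuns n as) f
      (as-complete (f zero)) (allFuns-complete as-complete n (tail f))

  allFuns⁺ : ∀ {as} → UniqueB as → ∀ n → Uniqueᵛ (allFuns n as)
  allFuns⁺ as! zero = [] ∷ []
  allFuns⁺ {as} as! (suc n) = Prepend.prepend⁺ _ (λ a g → λ { zero → refl ; (suc i) → refl }) (allFuns n as)
    (allFuns⁺ as! n) as!

  length-allFuns : ∀ as n → length (allFuns n as) ≡ length as ℕ.^ n
  length-allFuns as zero = refl
  length-allFuns as (suc n) = trans
    (Prepend.length-prepend _ (λ a g → λ { zero → refl ; (suc i) → refl }) (allFuns n as) as)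
    (cong (length as *_) (length-allFuns as n))

-- Orbit counting for actions of ℤ/k

record PeriodicAction (S : DecSetoid 0ℓ 0ℓ) (k : ℕ) : Set where
  open DecSetoid S using (Carrier; _≈_)
  field
    act        : ℕ → Carrier → Carrier
    act-cong   : ∀ t {x y} → x ≈ y → act t x ≈ act t y
    act-+      : ∀ s t x → act (s + t) x ≈ act s (act t x)
    act-period : ∀ x → act k x ≈ x

+[m+n]-+m≡+n : ∀ m n → + (m + n) - + m ≡ + n
+[m+n]-+m≡+n m n = trans (ℤ.m-n≡m⊖n (m + n) m)
  (trans (cong ((m + n) ℤ.⊖_) (sym (+-identityʳ m))) (ℤ.+-cancelˡ-⊖ m n 0))

module OrbitCounting {S : DecSetoid 0ℓ 0ℓ} {k : ℕ} (G : PeriodicAction S k) where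
  open DecSetoid S using (Carrier; _≈_; _≟_; setoid) renaming (refl to ≈-refl; sym to ≈-sym; trans to ≈-trans)
  open PeriodicAction G public
  open DecMembership S using (_∈_; _∈?_)
  open UniqueS setoid using (Unique)
  open UniqueLength S using (unique∧⊆∧⊇⇒length≡)
  open SetoidReasoning setoid

  Fixed : Pred Carrier 0ℓ
  Fixed x = act 1 x ≈ x

  fixed? : Decidable Fixed
  fixed? x = act 1 x ≟ x

  Fixed-resp : ∀ {x y} → x ≈ y → Fixed x → Fixed y
  Fixed-resp {x} {y} x≈y x-fixed = begin
    act 1 y ≈⟨ act-cong 1 (≈-sym x≈y) ⟩
    act 1 x ≈⟨ x-fixed ⟩
    x       ≈⟨ x≈y ⟩
    y       ∎

  act-0 : ∀ x → act 0 x ≈ x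
  act-0 x = begin
    act 0 x         ≈⟨ act-cong 0 (act-period x) ⟨
    act 0 (act k x) ≈⟨ act-+ 0 k x ⟨
    act k x         ≈⟨ act-period x ⟩
    x               ∎

  act-comm : ∀ s t x → act s (act t x) ≈ act t (act s x)
  act-comm s t x = begin
    act s (act t x) ≈⟨ act-+ s t x ⟨
    act (s + t) x   ≡⟨ cong (λ u → act u x) (+-comm s t) ⟩
    act (t + s) x   ≈⟨ act-+ t s x ⟩
    act t (act s x) ∎

  stable-* : ∀ {d x} → act d x ≈ x → ∀ q → act (q * d) x ≈ x
  stable-* {d} {x} _ zero = act-0 x
  stable-* {d} {x} d-stable (suc q) = begin
    act (d + q * d) x     ≈⟨ act-+ d (q * d) x ⟩
    act d (act (q * d) x) ≈⟨ act-cong d (stable-* d-stable q) ⟩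
    act d x               ≈⟨ d-stable ⟩
    x                     ∎

  fixed⇒stable : ∀ {x} → Fixed x → ∀ t → act t x ≈ x
  fixed⇒stable x-fixed t = subst (λ t → act t _ ≈ _) (*-identityʳ t) (stable-* x-fixed t)

  Closed : Pred (List Carrier) 0ℓ
  Closed xs = ∀ {x} → x ∈ xs → act 1 x ∈ xs

  act-∈-closed : ∀ {xs x} → Closed xs → x ∈ xs → ∀ t → act t x ∈ xs
  act-∈-closed {x = x} _ x∈xs zero = ∈-resp-≈ setoid (≈-sym (act-0 x)) x∈xs
  act-∈-closed {x = x} closed x∈xs (suc t) =
    ∈-resp-≈ setoid (≈-sym (act-+ 1 t x)) (closed (act-∈-closed closed x∈xs t))

  module _ .{{_ : NonZero k}} where

    act-mod : ∀ t x → act t x ≈ act (t % k) x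
    act-mod t x = begin
      act t x                           ≡⟨ cong (λ t → act t x) (m≡m%n+[m/n]*n t k) ⟩
      act (t % k + (t / k) * k) x       ≈⟨ act-+ (t % k) ((t / k) * k) x ⟩
      act (t % k) (act ((t / k) * k) x) ≈⟨ act-cong (t % k) (stable-* (act-period x) (t / k)) ⟩
      act (t % k) x                     ∎

    act-inverseˡ : ∀ x → act (k ∸ 1) (act 1 x) ≈ x
    act-inverseˡ x = begin
      act (k ∸ 1) (act 1 x) ≈⟨ act-+ (k ∸ 1) 1 x ⟨
      act (k ∸ 1 + 1) x     ≡⟨ cong (λ t → act t x) (m∸n+n≡m (>-nonZero⁻¹ k)) ⟩
      act k x               ≈⟨ act-period x ⟩
      x                     ∎

    act-inverseʳ : ∀ x → act 1 (act (k ∸ 1) x) ≈ x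
    act-inverseʳ x = begin
      act 1 (act (k ∸ 1) x) ≈⟨ act-+ 1 (k ∸ 1) x ⟨
      act (1 + (k ∸ 1)) x   ≡⟨ cong (λ t → act t x) (m+[n∸m]≡n (>-nonZero⁻¹ k)) ⟩
      act k x               ≈⟨ act-period x ⟩
      x                     ∎

    act-1-injective : ∀ {x y} → act 1 x ≈ act 1 y → x ≈ y
    act-1-injective {x} {y} eq = begin
      x                     ≈⟨ act-inverseˡ x ⟨
      act (k ∸ 1) (act 1 x) ≈⟨ act-cong (k ∸ 1) eq ⟩
      act (k ∸ 1) (act 1 y) ≈⟨ act-inverseˡ y ⟩
      y                     ∎

  module _ (k-prime : Prime k) where
    private instance
      k≢0 : NonZero k
      k≢0 = prime⇒nonZero k-prime

    period<k⇒fixed : ∀ {d x} → 0 < d → d < k → act d x ≈ x → Fixed x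
    period<k⇒fixed {d} {x} 0<d d<k d-stable
      with coprime-Bézout (prime⇒coprime k-prime {{>-nonZero 0<d}} d<k)
    ... | Bézout.+- a b 1+bd≡ak = begin
      act 1 x               ≈⟨ act-cong 1 (stable-* d-stable b) ⟨
      act 1 (act (b * d) x) ≈⟨ act-+ 1 (b * d) x ⟨
      act (1 + b * d) x     ≡⟨ cong (λ t → act t x) 1+bd≡ak ⟩
      act (a * k) x         ≈⟨ stable-* (act-period x) a ⟩
      x                     ∎
    ... | Bézout.-+ a b 1+ak≡bd = begin
      act 1 x               ≈⟨ act-cong 1 (stable-* (act-period x) a) ⟨
      act 1 (act (a * k) x) ≈⟨ act-+ 1 (a * k) x ⟨
      act (1 + a * k) x     ≡⟨ cong (λ t → act t x) 1+ak≡bd ⟩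
      act (b * d) x         ≈⟨ stable-* d-stable b ⟩
      x                     ∎

    orbit : Carrier → List Carrier
    orbit x = applyUpTo (λ i → act i x) k

    act-∈-orbit : ∀ t x → act t x ∈ orbit x
    act-∈-orbit t x = ∈-resp-≈ setoid (≈-sym (act-mod t x)) (∈-applyUpTo⁺ setoid (λ i → act i x) (m%n<n t k))

    orbit-closed : ∀ {x y} t → y ∈ orbit x → act t y ∈ orbit x
    orbit-closed {x} t y∈ with ∈-applyUpTo⁻ setoid (λ i → act i x) y∈
    ... | i , _ , y≈act-i = ∈-resp-≈ setoid
      (≈-trans (act-+ t i x) (act-cong t (≈-sym y≈act-i))) (act-∈-orbit (t + i) x)

    orbit⊆ : ∀ {xs x y} → Closed xs → x ∈ xs → y ∈ orbit x → y ∈ xs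
    orbit⊆ {x = x} closed x∈xs y∈ with ∈-applyUpTo⁻ setoid (λ i → act i x) y∈
    ... | i , _ , y≈act-i = ∈-resp-≈ setoid (≈-sym y≈act-i) (act-∈-closed closed x∈xs i)

    orbit-unique : ∀ {x} → ¬ Fixed x → Unique (orbit x)
    orbit-unique {x} x-free = Unique.applyUpTo⁺₁ setoid (λ i → act i x) k distinct
      where
      distinct : ∀ {i j} → i < j → j < k → ¬ act i x ≈ act j x
      distinct {i} {j} i<j j<k act-i≈act-j = x-free (period<k⇒fixed 0<d d<k d-stable)
        where
        d = k ∸ j + i
        0<d : 0 < d
        0<d = ≤-trans (m<n⇒0<n∸m j<k) (m≤m+n (k ∸ j) i)
        d<k : d < k
        d<k = ≤-trans (+-monoʳ-< (k ∸ j) i<j) (≤-reflexive (m∸n+n≡m (<⇒≤ j<k)))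
        d-stable : act d x ≈ x
        d-stable = begin
          act (k ∸ j + i) x       ≈⟨ act-+ (k ∸ j) i x ⟩
          act (k ∸ j) (act i x)   ≈⟨ act-cong (k ∸ j) act-i≈act-j ⟩
          act (k ∸ j) (act j x)   ≈⟨ act-+ (k ∸ j) j x ⟨
          act (k ∸ j + j) x       ≡⟨ cong (λ t → act t x) (m∸n+n≡m (<⇒≤ j<k)) ⟩
          act k x                 ≈⟨ act-period x ⟩
          x                       ∎

    -- The orbit of the head of xs consists of k elements of xs; remove them and recurse.
    k∣length-free : ∀ {xs} → Acc (_<_ on length) xs → Unique xs → Closed xs →
                    (∀ {x} → x ∈ xs → ¬ Fixed x) → k ℕ.∣ length xs
    k∣length-free {[]} _ _ _ _ = k ℕ.∣0
    k∣length-free {xs@(x ∷ _)} (acc smaller) xs! closed free =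
      subst (k ℕ.∣_) split (ℕ.∣m∣n⇒∣m+n ℕ.∣-refl
        (k∣length-free (smaller rest<xs) (Unique.filter⁺ setoid ∉O? xs!) rest-closed rest-free))
      where
      O = orbit x
      ∉O? = ∁? (_∈? O)
      rest = filter ∉O? xs

      length-xs∩O : length (filter (_∈? O) xs) ≡ k
      length-xs∩O = trans
        (unique∧⊆∧⊇⇒length≡ (Unique.filter⁺ setoid (_∈? O) xs!) (orbit-unique (free (here ≈-refl)))
          (λ y∈ → proj₂ (∈-filter⁻ setoid (_∈? O) (∈-resp-≈ setoid) y∈))
          (λ y∈O → ∈-filter⁺ setoid (_∈? O) (∈-resp-≈ setoid) (orbit⊆ closed (here ≈-refl) y∈O) y∈O))
        (length-applyUpTo (λ i → act i x) k)

      split : k + length rest ≡ length xs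
      split = trans (cong (_+ length rest) (sym length-xs∩O)) (length-filter+filter-∁ (_∈? O) xs)

      rest<xs : length rest < length xs
      rest<xs = subst (length rest <_) split (m<n+m (length rest) (>-nonZero⁻¹ k))

      rest-closed : Closed rest
      rest-closed y∈rest with ∈-filter⁻ setoid ∉O? (∉-resp-≈ setoid) y∈rest
      ... | y∈xs , y∉O = ∈-filter⁺ setoid ∉O? (∉-resp-≈ setoid) (closed y∈xs)
        λ act-1-y∈O → y∉O (∈-resp-≈ setoid (act-inverseˡ _) (orbit-closed (k ∸ 1) act-1-y∈O))

      rest-free : ∀ {y} → y ∈ rest → ¬ Fixed y
      rest-free y∈rest = free (proj₁ (∈-filter⁻ setoid ∉O? (∉-resp-≈ setoid) y∈rest))

    length≡length-fixed-mod-k : ∀ {xs} → Unique xs → Closed xs →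
                              + k ℤ.∣ + length xs - + length (filter fixed? xs)
    length≡length-fixed-mod-k {xs} xs! closed = subst (+ k ℤ.∣_) (sym difference) (ℤ.∣ᵤ⇒∣ k∣free)
      where
      free? = ∁? fixed?
      free = filter free? xs
      F = length (filter fixed? xs)

      free-resp : ∀ {x y} → x ≈ y → ¬ Fixed x → ¬ Fixed y
      free-resp x≈y x-free y-fixed = x-free (Fixed-resp (≈-sym x≈y) y-fixed)

      free-closed : Closed free
      free-closed y∈ with ∈-filter⁻ setoid free? free-resp y∈
      ... | y∈xs , y-free = ∈-filter⁺ setoid free? free-resp (closed y∈xs)
        λ act-1-y-fixed → y-free (act-1-injective act-1-y-fixed)

      k∣free : k ℕ.∣ length free
      k∣free = k∣length-free (On.wellFounded length <-wellFounded free) (Unique.filter⁺ setoid free? xs!)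
        free-closed λ y∈ → proj₂ (∈-filter⁻ setoid free? free-resp {xs = xs} y∈)

      difference : + length xs - + F ≡ + length free
      difference = trans (cong (λ n → + n - + F) (sym (length-filter+filter-∁ fixed? xs)))
        (+[m+n]-+m≡+n F (length free))

module _ {n k : ℕ} (I : PeriodicAction (Finₚ.≡-decSetoid n) k) (A : DecSetoid 0ℓ 0ℓ) where
  open PeriodicAction I renaming (act to π; act-+ to π-+; act-period to π-period)
  open DecSetoid A using (reflexive)

  π-+ᵒᵖ : ∀ s t i → π (s + t) i ≡ π t (π s i)
  π-+ᵒᵖ s t i = trans (cong (λ u → π u i) (+-comm s t)) (π-+ t s i)

  precomposition : PeriodicAction (Pointwise.decSetoid A n) k
  precomposition = record
    { act        = λ t w → w ∘ π t
    ; act-cong   = λ t w≋v i → w≋v (π t i)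
    ; act-+      = λ s t w i → reflexive (cong w (π-+ᵒᵖ s t i))
    ; act-period = λ w i → reflexive (cong w (π-period i))
    }

  conjugation : PeriodicAction (Pointwise.decSetoid (Pointwise.decSetoid A n) n) k
  conjugation = record
    { act        = λ t R i j → R (π t i) (π t j)
    ; act-cong   = λ t R≋S i j → R≋S (π t i) (π t j)
    ; act-+      = λ s t R i j → reflexive (cong₂ R (π-+ᵒᵖ s t i) (π-+ᵒᵖ s t j))
    ; act-period = λ R i j → reflexive (cong₂ R (π-period i) (π-period j))
    }

-- Rotations, necklaces and Fermat's little theorem

module Rotation (k : ℕ) .{{_ : NonZero k}} where

  rotate : ℕ → Fin k → Fin k
  rotate t b = (toℕ b + t) mod k

  toℕ-rotate : ∀ t b → toℕ (rotate t b) ≡ (toℕ b + t) % k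
  toℕ-rotate t b = toℕ-fromℕ< _

  rotate-+ : ∀ s t b → rotate (s + t) b ≡ rotate s (rotate t b)
  rotate-+ s t b = toℕ-injective (begin
    toℕ (rotate (s + t) b)             ≡⟨ toℕ-rotate (s + t) b ⟩
    (toℕ b + (s + t)) % k              ≡⟨ cong (_% k) (x∙yz≈xz∙y (toℕ b) s t) ⟩
    (toℕ b + t + s) % k                ≡⟨ %-distribˡ-+ (toℕ b + t) s k ⟩
    ((toℕ b + t) % k + s % k) % k      ≡⟨ cong (λ x → (x + s % k) % k) (m%n%n≡m%n (toℕ b + t) k) ⟨
    ((toℕ b + t) % k % k + s % k) % k  ≡⟨ %-distribˡ-+ ((toℕ b + t) % k) s k ⟨
    ((toℕ b + t) % k + s) % k          ≡⟨ cong (λ x → (x + s) % k) (toℕ-rotate t b) ⟨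
    (toℕ (rotate t b) + s) % k         ≡⟨ toℕ-rotate s (rotate t b) ⟨
    toℕ (rotate s (rotate t b))        ∎)
    where open ≡-Reasoning

  rotate-period : ∀ b → rotate k b ≡ b
  rotate-period b = toℕ-injective
    (trans (toℕ-rotate k b) (trans ([m+n]%n≡m%n (toℕ b) k) (m<n⇒m%n≡m (toℕ<n b))))

  rotate-difference : ∀ b c → rotate (toℕ c + (k ∸ toℕ b)) b ≡ c
  rotate-difference b c = toℕ-injective (begin
    toℕ (rotate (toℕ c + (k ∸ toℕ b)) b)   ≡⟨ toℕ-rotate _ b ⟩
    (toℕ b + (toℕ c + (k ∸ toℕ b))) % k    ≡⟨ cong (_% k) (x∙yz≈y∙xz (toℕ b) (toℕ c) (k ∸ toℕ b)) ⟩
    (toℕ c + (toℕ b + (k ∸ toℕ b))) % k    ≡⟨ cong (λ x → (toℕ c + x) % k) (m+[n∸m]≡n (<⇒≤ (toℕ<n b))) ⟩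
    (toℕ c + k) % k                        ≡⟨ [m+n]%n≡m%n (toℕ c) k ⟩
    toℕ c % k                              ≡⟨ m<n⇒m%n≡m (toℕ<n c) ⟩
    toℕ c                                  ∎)
    where open ≡-Reasoning

  rotation : PeriodicAction (Finₚ.≡-decSetoid k) k
  rotation = record
    { act = rotate ; act-cong = λ t → cong (rotate t) ; act-+ = rotate-+ ; act-period = rotate-period }

  origin : Fin k
  origin = fromℕ< (>-nonZero⁻¹ k)

module Necklaces {p : ℕ} (p-prime : Prime p) (a : ℕ) where
  private instance
    p≢0 : NonZero p
    p≢0 = prime⇒nonZero p-prime

  open Rotation p
  open OrbitCounting (precomposition rotation (Finₚ.≡-decSetoid a))
  open FunctionEnumeration (Finₚ.≡-setoid a)

  Words : DecSetoid 0ℓ 0ℓ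
  Words = Pointwise.decSetoid (Finₚ.≡-decSetoid a) p

  open DecSetoid Words using () renaming (setoid to words-setoid)

  words : List (Vector (Fin a) p)
  words = allFuns p (allFin a)

  length-words : length words ≡ a ℕ.^ p
  length-words = trans (length-allFuns (allFin a) p) (cong (ℕ._^ p) (length-tabulate {n = a} id))

  fixed⇒constant : ∀ {w} → Fixed w → ∀ b → w b ≡ w origin
  fixed⇒constant {w} w-fixed b = begin
    w b                                          ≡⟨ cong w (rotate-difference origin b) ⟨
    w (rotate (toℕ b + (p ∸ toℕ origin)) origin) ≡⟨ fixed⇒stable w-fixed _ origin ⟩
    w origin                                     ∎
    where open ≡-Reasoning

  length-fixed-words : length (filter fixed? words) ≡ a
  length-fixed-words = trans
    (UniqueLength.length≡length-map Words (Finₚ.≡-setoid a) (λ c≋c′ → c≋c′ origin)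
      (Unique.filter⁺ words-setoid fixed? (allFuns⁺ (allFin⁺ a) p)) (allFin⁺ a)
      fixed⊆constants constants⊆fixed)
    (length-tabulate {n = a} id)
    where
    fixed⊆constants : ∀ {w} → w ∈ᵛ filter fixed? words → w ∈ᵛ map const (allFin a)
    fixed⊆constants {w} w∈ = ∈-resp-≈ words-setoid (λ b → sym (fixed⇒constant w-fixed b))
      (∈-map⁺ (Finₚ.≡-setoid a) words-setoid (λ x≡y _ → x≡y) (∈-allFin (w origin)))
      where w-fixed = proj₂ (∈-filter⁻ words-setoid fixed? Fixed-resp {xs = words} w∈)
    constants⊆fixed : ∀ {w} → w ∈ᵛ map const (allFin a) → w ∈ᵛ filter fixed? words
    constants⊆fixed {w} w∈ with ∈-map⁻ (Finₚ.≡-setoid a) words-setoid w∈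
    ... | c , _ , w≋c = ∈-filter⁺ words-setoid fixed? Fixed-resp (allFuns-complete ∈-allFin p w)
      λ b → trans (w≋c (rotate 1 b)) (sym (w≋c b))

  words-congruence : + p ℤ.∣ + length words - + length (filter fixed? words)
  words-congruence = length≡length-fixed-mod-k p-prime (allFuns⁺ (allFin⁺ a) p)
    (λ {w} _ → allFuns-complete ∈-allFin p (act 1 w))

fermat : ∀ {p} → Prime p → ∀ a → + p ℤ.∣ + (a ℕ.^ p) - + a
fermat p-prime a = subst₂ (λ x y → + _ ℤ.∣ + x - + y) length-words length-fixed-words words-congruence
  where open Necklaces p-prime a

-- Posets invariant under a shift of the top points

¬T⇒≡false : ∀ {b} → ¬ T b → b ≡ false
¬T⇒≡false {true} ¬T = ⊥-elim (¬T tt)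
¬T⇒≡false {false} _ = refl

module _ {n m : ℕ} where

  Good-resp : ∀ {R S : BRel n} → (∀ i j → R i j ≡ S i j) → Good m R → Good m S
  Good-resp {R} {S} R≗S ((refl′ , antisym , trans′) , minimals) =
    (refl″ , antisym′ , trans″) , minimals′
    where
    to : ∀ {i j} → T (R i j) → T (S i j)
    to {i} {j} = subst T (R≗S i j)
    from : ∀ {i j} → T (S i j) → T (R i j)
    from {i} {j} = subst T (sym (R≗S i j))
    refl″ : Refl S
    refl″ i = to (refl′ i)
    antisym′ : Antisym S
    antisym′ i j Sij Sji = antisym i j (from Sij) (from Sji)
    trans″ : Trans S
    trans″ i j l Sij Sjl = to (trans′ i j l (from Sij) (from Sjl))
    minimals′ : MinimalsExactly m S
    minimals′ i = (λ i-min → proj₁ (minimals i) (λ j Rji → i-min j (to Rji)))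
                , (λ i<m j Sji → proj₂ (minimals i) i<m j (from Sji))

  Good-conjugate : ∀ {R : BRel n} (p q : Fin n → Fin n) → (∀ i → p (q i) ≡ i) → (∀ i → q (p i) ≡ i) →
                   (∀ i → toℕ (p i) < m ⇔ toℕ i < m) → Good m R → Good m (λ i j → R (p i) (p j))
  Good-conjugate {R} p q pq qp p-bottom ((refl′ , antisym , trans′) , minimals) =
    (refl′ ∘ p , antisym′ , λ i j l → trans′ (p i) (p j) (p l)) , minimals′
    where
    antisym′ : Antisym (λ i j → R (p i) (p j))
    antisym′ i j Rij Rji = trans (sym (qp i)) (trans (cong q (antisym (p i) (p j) Rij Rji)) (qp j))
    minimal⇒ : ∀ i → IsMinimal (λ i j → R (p i) (p j)) i → IsMinimal R (p i)
    minimal⇒ i i-min j Rj = trans (sym (pq j)) (cong p (i-min (q j) (subst (λ x → T (R x (p i))) (sym (pq j)) Rj)))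
    minimal⇐ : ∀ i → IsMinimal R (p i) → IsMinimal (λ i j → R (p i) (p j)) i
    minimal⇐ i pi-min j Rj = trans (sym (qp j)) (trans (cong q (pi-min (p j) Rj)) (qp i))
    minimals′ : MinimalsExactly m (λ i j → R (p i) (p j))
    minimals′ i = (λ i-min → Equivalence.to (p-bottom i) (proj₁ (minimals (p i)) (minimal⇒ i i-min)))
                , (λ i<m → minimal⇐ i (proj₂ (minimals (p i)) (Equivalence.from (p-bottom i) i<m)))

module _ {n k : ℕ} (I : PeriodicAction (Finₚ.≡-decSetoid n) k) .{{_ : NonZero k}} where
  open OrbitCounting I using (act; act-0; act-+; act-comm; stable-*; act-period)

  Stable : BRel n → Set
  Stable R = ∀ t i j → R (act t i) (act t j) ≡ R i j

  -- σᵈ x ≤ σ²ᵈ x ≤ ⋯ ≤ σᵏᵈ x = x, each step being a translate of x ≤ σᵈ x.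
  stable-preorder-symmetric : ∀ {R} → Refl R → Trans R → Stable R →
                              ∀ d x → T (R x (act d x)) → T (R (act d x) x)
  stable-preorder-symmetric {R} refl′ trans′ stable d x Rx[dx] =
    subst (λ z → T (R (act d x) z)) back (chain (step Rx[dx] d) (k ∸ 1))
    where
    step : ∀ {u} → T (R u (act d u)) → ∀ t → T (R (act t u) (act d (act t u)))
    step {u} Ru[du] t =
      subst (λ z → T (R (act t u) z)) (act-comm t d u) (subst T (sym (stable t u (act d u))) Ru[du])
    chain : ∀ {u} → T (R u (act d u)) → ∀ q → T (R u (act (q * d) u))
    chain {u} _ zero = subst (λ z → T (R u z)) (sym (act-0 u)) (refl′ u)
    chain {u} Ru[du] (suc q) = trans′ u _ _ (chain Ru[du] q)
      (subst (λ z → T (R (act (q * d) u) z)) (sym (act-+ d (q * d) u)) (step Ru[du] (q * d)))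
    back : act ((k ∸ 1) * d) (act d x) ≡ x
    back = begin
      act ((k ∸ 1) * d) (act d x) ≡⟨ act-comm ((k ∸ 1) * d) d x ⟩
      act d (act ((k ∸ 1) * d) x) ≡⟨ act-+ d ((k ∸ 1) * d) x ⟨
      act (suc (k ∸ 1) * d) x     ≡⟨ cong (λ t → act (t * d) x) (suc-pred k) ⟩
      act (k * d) x               ≡⟨ cong (λ t → act t x) (*-comm k d) ⟩
      act (d * k) x               ≡⟨ stable-* (act-period x) d ⟩
      x                           ∎
      where open ≡-Reasoning

module Shift (m k : ℕ) .{{_ : NonZero k}} where
  open Rotation k

  data BottomOrTop : Fin (m + k) → Set where
    bottom : (a : Fin m) → BottomOrTop (a ↑ˡ k)
    top    : (b : Fin k) → BottomOrTop (m ↑ʳ b)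

  split : Fin (m + k) → Fin m ⊎ Fin k
  split = splitAt m

  bottomOrTop : ∀ i → BottomOrTop i
  bottomOrTop i with split i in eq
  ... | inj₁ a = subst BottomOrTop (Finₚ.splitAt⁻¹-↑ˡ eq) (bottom a)
  ... | inj₂ b = subst BottomOrTop (Finₚ.splitAt⁻¹-↑ʳ eq) (top b)

  bottom<m : ∀ (a : Fin m) → toℕ (a ↑ˡ k) < m
  bottom<m a = subst (_< m) (sym (Finₚ.toℕ-↑ˡ a k)) (Finₚ.toℕ<n a)

  top≮m : ∀ (b : Fin k) → ¬ toℕ (m ↑ʳ b) < m
  top≮m b top<m = <⇒≱ top<m (subst (m ≤_) (sym (Finₚ.toℕ-↑ʳ m b)) (m≤m+n m (toℕ b)))

  bottom≢top : ∀ (a : Fin m) (b : Fin k) → a ↑ˡ k ≢ m ↑ʳ b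
  bottom≢top a b eq = top≮m b (subst (λ i → toℕ i < m) eq (bottom<m a))

  shift : ℕ → Fin (m + k) → Fin (m + k)
  shift t i = join m k (Sum.map₂ (rotate t) (split i))

  split-shift : ∀ t i → split (shift t i) ≡ Sum.map₂ (rotate t) (split i)
  split-shift t i = Finₚ.splitAt-join m k _

  shift-bottom : ∀ t a → shift t (a ↑ˡ k) ≡ a ↑ˡ k
  shift-bottom t a rewrite Finₚ.splitAt-↑ˡ m a k = refl

  shift-top : ∀ t b → shift t (m ↑ʳ b) ≡ m ↑ʳ rotate t b
  shift-top t b rewrite Finₚ.splitAt-↑ʳ m k b = refl

  shift-+ : ∀ s t i → shift (s + t) i ≡ shift s (shift t i)
  shift-+ s t i with bottomOrTop i
  ... | bottom a = trans (shift-bottom (s + t) a) (sym (trans (cong (shift s) (shift-bottom t a)) (shift-bottom s a)))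
  ... | top b = begin
    shift (s + t) (m ↑ʳ b)        ≡⟨ shift-top (s + t) b ⟩
    m ↑ʳ rotate (s + t) b         ≡⟨ cong (m ↑ʳ_) (rotate-+ s t b) ⟩
    m ↑ʳ rotate s (rotate t b)    ≡⟨ shift-top s (rotate t b) ⟨
    shift s (m ↑ʳ rotate t b)     ≡⟨ cong (shift s) (shift-top t b) ⟨
    shift s (shift t (m ↑ʳ b))    ∎
    where open ≡-Reasoning

  shift-period : ∀ i → shift k i ≡ i
  shift-period i with bottomOrTop i
  ... | bottom a = shift-bottom k a
  ... | top b = trans (shift-top k b) (cong (m ↑ʳ_) (rotate-period b))

  shifting : PeriodicAction (Finₚ.≡-decSetoid (m + k)) k
  shifting = record
    { act = shift ; act-cong = λ t → cong (shift t) ; act-+ = shift-+ ; act-period = shift-period }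

  open OrbitCounting shifting public using ()
    renaming (act-inverseˡ to shift-inverseˡ; act-inverseʳ to shift-inverseʳ; act-1-injective to shift-1-injective)

  shift-preserves-bottom : ∀ t i → toℕ (shift t i) < m ⇔ toℕ i < m
  shift-preserves-bottom t i with bottomOrTop i
  ... | bottom a = mk⇔ (λ _ → bottom<m a) (λ _ → subst (λ i → toℕ i < m) (sym (shift-bottom t a)) (bottom<m a))
  ... | top b = mk⇔ (λ lt → ⊥-elim (top≮m (rotate t b) (subst (λ i → toℕ i < m) (shift-top t b) lt)))
                    (λ lt → ⊥-elim (top≮m b lt))

module FixedPosets (m k : ℕ) .{{_ : NonZero k}} where
  open Rotation k
  open Shift m k
  open Finₚ using (_≟_)

  strict : (Fin m → Bool) → Fin m ⊎ Fin k → Fin m ⊎ Fin k → Bool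
  strict S (inj₁ a) (inj₂ _) = S a
  strict S (inj₁ _) (inj₁ _) = false
  strict S (inj₂ _) _        = false

  cone : (Fin m → Bool) → BRel (m + k)
  cone S i j = does (i ≟ j) ∨ strict S (split i) (split j)

  strict-chain : ∀ {S} x y z → T (strict S x y) → ¬ T (strict S y z)
  strict-chain (inj₁ _) (inj₂ _) _ _ ()

  strict-bottom : ∀ {S} x a → ¬ T (strict S x (inj₁ a))
  strict-bottom (inj₁ _) _ ()
  strict-bottom (inj₂ _) _ ()

  strict-map₂ : ∀ S r x y → strict S (Sum.map₂ r x) (Sum.map₂ r y) ≡ strict S x y
  strict-map₂ S r (inj₁ a) (inj₁ _) = refl
  strict-map₂ S r (inj₁ a) (inj₂ _) = refl
  strict-map₂ S r (inj₂ _) _        = refl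

  strict-cong : ∀ {S S′} → (∀ a → S a ≡ S′ a) → ∀ x y → strict S x y ≡ strict S′ x y
  strict-cong S≗S′ (inj₁ a) (inj₁ _) = refl
  strict-cong S≗S′ (inj₁ a) (inj₂ _) = S≗S′ a
  strict-cong S≗S′ (inj₂ _) _        = refl

  cone-refl : ∀ S i → cone S i i ≡ true
  cone-refl S i = cong (_∨ strict S (split i) (split i)) (dec-true (i ≟ i) refl)

  cone-≢ : ∀ S {i j} → i ≢ j → cone S i j ≡ strict S (split i) (split j)
  cone-≢ S {i} {j} i≢j = cong (_∨ strict S (split i) (split j)) (dec-false (i ≟ j) i≢j)

  T-cone : ∀ {S i j} → T (cone S i j) → i ≡ j ⊎ T (strict S (split i) (split j))
  T-cone {S} {i} {j} i≤j with i ≟ j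
  ... | yes i≡j = inj₁ i≡j
  ... | no _    = inj₂ i≤j

  cone-bottom-top : ∀ S a b → cone S (a ↑ˡ k) (m ↑ʳ b) ≡ S a
  cone-bottom-top S a b = trans (cone-≢ S (bottom≢top a b))
    (cong₂ (strict S) (Finₚ.splitAt-↑ˡ m a k) (Finₚ.splitAt-↑ʳ m k b))

  cone-bottom-minimal : ∀ S a → IsMinimal (cone S) (a ↑ˡ k)
  cone-bottom-minimal S a j j≤a with T-cone {S} j≤a
  ... | inj₁ j≡a = j≡a
  ... | inj₂ j<a = ⊥-elim (strict-bottom (split j) a (subst (T ∘ strict S (split j)) (Finₚ.splitAt-↑ˡ m a k) j<a))

  Nonempty : (Fin m → Bool) → Set
  Nonempty S = ∃ λ a → T (S a)

  nonempty? : Decidable Nonempty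
  nonempty? S = Finₚ.any? (λ a → T? (S a))

  Nonempty-resp : ∀ {S S′} → (∀ a → S a ≡ S′ a) → Nonempty S → Nonempty S′
  Nonempty-resp S≗S′ (a , Sa) = a , subst T (S≗S′ a) Sa

  cone-good : ∀ {S} → Nonempty S → Good m (cone S)
  cone-good {S} (a₀ , Sa₀) = (refl′ , antisym , trans′) , minimals
    where
    refl′ : Refl (cone S)
    refl′ i = subst T (sym (cone-refl S i)) tt
    antisym : Antisym (cone S)
    antisym i j i≤j j≤i with T-cone {S} i≤j | T-cone {S} j≤i
    ... | inj₁ i≡j | _        = i≡j
    ... | inj₂ _   | inj₁ j≡i = sym j≡i
    ... | inj₂ i<j | inj₂ j<i = ⊥-elim (strict-chain (split i) (split j) (split i) i<j j<i)
    trans′ : Trans (cone S)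
    trans′ i j l i≤j j≤l with T-cone {S} i≤j | T-cone {S} j≤l
    ... | inj₁ refl | _        = j≤l
    ... | inj₂ _    | inj₁ refl = i≤j
    ... | inj₂ i<j  | inj₂ j<l  = ⊥-elim (strict-chain (split i) (split j) (split l) i<j j<l)
    minimals : MinimalsExactly m (cone S)
    minimals i with bottomOrTop i
    ... | bottom a = (λ _ → bottom<m a) , (λ _ → cone-bottom-minimal S a)
    ... | top b = (λ b-min → ⊥-elim (bottom≢top a₀ b (b-min (a₀ ↑ˡ k) a₀≤b))) , (λ b<m → ⊥-elim (top≮m b b<m))
      where
      a₀≤b : T (cone S (a₀ ↑ˡ k) (m ↑ʳ b))
      a₀≤b = subst T (sym (cone-bottom-top S a₀ b)) Sa₀

  open OrbitCounting (conjugation shifting Bool.≡-decSetoid)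

  shift-1-does : ∀ i j → does (shift 1 i ≟ shift 1 j) ≡ does (i ≟ j)
  shift-1-does i j with i ≟ j
  ... | yes refl = dec-true (shift 1 i ≟ shift 1 i) refl
  ... | no i≢j   = dec-false (shift 1 i ≟ shift 1 j) (i≢j ∘ shift-1-injective)

  cone-fixed : ∀ S → Fixed (cone S)
  cone-fixed S i j = cong₂ _∨_ (shift-1-does i j)
    (trans (cong₂ (strict S) (split-shift 1 i) (split-shift 1 j)) (strict-map₂ S (rotate 1) (split i) (split j)))

  cone-cong : ∀ {S S′} → (∀ a → S a ≡ S′ a) → ∀ i j → cone S i j ≡ cone S′ i j
  cone-cong S≗S′ i j = cong (does (i ≟ j) ∨_) (strict-cong S≗S′ (split i) (split j))

  belowTop : BRel (m + k) → Fin m → Bool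
  belowTop R a = R (a ↑ˡ k) (m ↑ʳ origin)

  cone-injective : ∀ {S S′} → (∀ i j → cone S i j ≡ cone S′ i j) → ∀ a → S a ≡ S′ a
  cone-injective {S} {S′} cone≗cone a =
    trans (sym (cone-bottom-top S a origin)) (trans (cone≗cone _ _) (cone-bottom-top S′ a origin))

  module _ {R : BRel (m + k)} (R-good : Good m R) (R-fixed : Fixed R) where
    private
      R-refl = proj₁ (proj₁ R-good)
      R-antisym = proj₁ (proj₂ (proj₁ R-good))
      R-trans = proj₂ (proj₂ (proj₁ R-good))
      R-minimals = proj₂ R-good

      R-stable : Stable shifting R
      R-stable t = fixed⇒stable R-fixed t

      top₀ : Fin (m + k)
      top₀ = m ↑ʳ origin

    top-antichain : ∀ b c → T (R (m ↑ʳ b) (m ↑ʳ c)) → b ≡ c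
    top-antichain b c b≤c = Finₚ.↑ʳ-injective m b c (R-antisym _ _ b≤c c≤b)
      where
      d = toℕ c + (k ∸ toℕ b)
      shift-d : shift d (m ↑ʳ b) ≡ m ↑ʳ c
      shift-d = trans (shift-top d b) (cong (m ↑ʳ_) (rotate-difference b c))
      c≤b : T (R (m ↑ʳ c) (m ↑ʳ b))
      c≤b = subst (λ x → T (R x (m ↑ʳ b))) shift-d
        (stable-preorder-symmetric shifting R-refl R-trans R-stable d (m ↑ʳ b)
          (subst (λ y → T (R (m ↑ʳ b) y)) (sym shift-d) b≤c))

    bottom-top : ∀ a b → R (a ↑ˡ k) (m ↑ʳ b) ≡ belowTop R a
    bottom-top a b = trans (sym (cong₂ R (shift-bottom d a) shift-d)) (R-stable d (a ↑ˡ k) top₀)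
      where
      d = toℕ b + (k ∸ toℕ origin)
      shift-d : shift d top₀ ≡ m ↑ʳ b
      shift-d = trans (shift-top d origin) (cong (m ↑ʳ_) (rotate-difference origin b))

    fixed-good⇒cone : ∀ i j → R i j ≡ cone (belowTop R) i j
    fixed-good⇒cone i j with i ≟ j
    ... | yes refl = Equivalence.to Bool.T-≡ (R-refl i)
    ... | no i≢j = R-strict (bottomOrTop i) (bottomOrTop j)
      where
      R-strict : BottomOrTop i → BottomOrTop j → R i j ≡ strict (belowTop R) (split i) (split j)
      R-strict _ (bottom a) rewrite Finₚ.splitAt-↑ˡ m a k = trans
        (¬T⇒≡false (i≢j ∘ proj₂ (R-minimals j) (bottom<m a) i))
        (sym (¬T⇒≡false (strict-bottom (split i) a)))
      R-strict (bottom a) (top b) rewrite Finₚ.splitAt-↑ˡ m a k | Finₚ.splitAt-↑ʳ m k b = bottom-top a b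
      R-strict (top b) (top c) rewrite Finₚ.splitAt-↑ʳ m k b =
        ¬T⇒≡false (i≢j ∘ cong (m ↑ʳ_) ∘ top-antichain b c)

    fixed-good⇒nonempty : Nonempty (belowTop R)
    fixed-good⇒nonempty with nonempty? (belowTop R)
    ... | yes nonempty = nonempty
    ... | no empty = ⊥-elim (top≮m origin (proj₁ (R-minimals top₀) top₀-minimal))
      where
      top₀-minimal : IsMinimal R top₀
      top₀-minimal j j≤top₀ = below (bottomOrTop j) j≤top₀
        where
        below : ∀ {j} → BottomOrTop j → T (R j top₀) → j ≡ top₀
        below (bottom a) a≤top₀ = ⊥-elim (empty (a , a≤top₀))
        below (top b) b≤top₀ = cong (m ↑ʳ_) (top-antichain b origin b≤top₀)

bools : List Bool
bools = true ∷ false ∷ []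

module PosetCount {k : ℕ} (k-prime : Prime k) (m : ℕ) where
  private instance
    k≢0 : NonZero k
    k≢0 = prime⇒nonZero k-prime

  open Shift m k
  open FixedPosets m k
  open OrbitCounting (conjugation shifting Bool.≡-decSetoid)

  Subsets : DecSetoid 0ℓ 0ℓ
  Subsets = Pointwise.decSetoid Bool.≡-decSetoid m

  Relations : DecSetoid 0ℓ 0ℓ
  Relations = Pointwise.decSetoid (Pointwise.decSetoid Bool.≡-decSetoid (m + k)) (m + k)

  open DecSetoid Subsets using () renaming (setoid to subsets-setoid)
  open DecSetoid Relations using () renaming (setoid to relations-setoid)
  open Membership Bool.≡-setoid using (_∈_)
  open UniqueS Bool.≡-setoid using (Unique)

  module Rows = FunctionEnumeration Bool.≡-setoid
  module Matrices = FunctionEnumeration (DecSetoid.setoid (Pointwise.decSetoid Bool.≡-decSetoid (m + k)))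

  bools-complete : ∀ b → b ∈ bools
  bools-complete true  = here refl
  bools-complete false = there (here refl)

  bools-unique : Unique bools
  bools-unique = ((λ ()) ∷ []) ∷ [] ∷ []

  subsets : List (Fin m → Bool)
  subsets = allFuns m bools

  posets : List (BRel (m + k))
  posets = filter (good? m) (allRels (m + k))

  fixedPosets : List (BRel (m + k))
  fixedPosets = filter fixed? posets

  relations-complete : ∀ R → R Matrices.∈ᵛ allRels (m + k)
  relations-complete = Matrices.allFuns-complete (Rows.allFuns-complete bools-complete (m + k)) (m + k)

  posets-unique : Matrices.Uniqueᵛ posets
  posets-unique = Unique.filter⁺ relations-setoid (good? m)
    (Matrices.allFuns⁺ (Rows.allFuns⁺ bools-unique (m + k)) (m + k))

  posets-closed : Closed posets
  posets-closed {R} R∈ with ∈-filter⁻ relations-setoid (good? m) Good-resp {xs = allRels (m + k)} R∈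
  ... | _ , R-good = ∈-filter⁺ relations-setoid (good? m) Good-resp (relations-complete (act 1 R))
    (Good-conjugate (shift 1) (shift (k ∸ 1)) shift-inverseʳ shift-inverseˡ (shift-preserves-bottom 1) R-good)

  length-fixed-posets : length fixedPosets ≡ length (filter nonempty? subsets)
  length-fixed-posets = UniqueLength.length≡length-map Relations subsets-setoid cone-injective
    (Unique.filter⁺ relations-setoid fixed? posets-unique)
    (Unique.filter⁺ subsets-setoid nonempty? (Rows.allFuns⁺ bools-unique m))
    fixed⊆cones cones⊆fixed
    where
    fixed⊆cones : ∀ {R} → R Matrices.∈ᵛ fixedPosets → R Matrices.∈ᵛ map cone (filter nonempty? subsets)
    fixed⊆cones {R} R∈ with ∈-filter⁻ relations-setoid fixed? Fixed-resp {xs = posets} R∈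
    ... | R∈posets , R-fixed with ∈-filter⁻ relations-setoid (good? m) Good-resp {xs = allRels (m + k)} R∈posets
    ... | _ , R-good = ∈-resp-≈ relations-setoid (λ i j → sym (fixed-good⇒cone R-good R-fixed i j))
      (∈-map⁺ subsets-setoid relations-setoid cone-cong
        (∈-filter⁺ subsets-setoid nonempty? Nonempty-resp (Rows.allFuns-complete bools-complete m _)
          (fixed-good⇒nonempty R-good R-fixed)))
    cones⊆fixed : ∀ {R} → R Matrices.∈ᵛ map cone (filter nonempty? subsets) → R Matrices.∈ᵛ fixedPosets
    cones⊆fixed {R} R∈ with ∈-map⁻ subsets-setoid relations-setoid R∈
    ... | S , S∈ , R≋cone = ∈-resp-≈ relations-setoid (λ i j → sym (R≋cone i j))
      (∈-filter⁺ relations-setoid fixed? Fixed-resp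
        (∈-filter⁺ relations-setoid (good? m) Good-resp (relations-complete (cone S))
          (cone-good (proj₂ (∈-filter⁻ subsets-setoid nonempty? Nonempty-resp {xs = subsets} S∈))))
        (cone-fixed S))

  length-empty-subsets : length (filter (∁? nonempty?) subsets) ≡ 1
  length-empty-subsets = UniqueLength.length≡length-map Subsets subsets-setoid {f = id} id
    (Unique.filter⁺ subsets-setoid (∁? nonempty?) (Rows.allFuns⁺ bools-unique m)) ([] ∷ [])
    empty⊆∅ ∅⊆empty
    where
    ∅ : Fin m → Bool
    ∅ _ = false
    Empty-resp : ∀ {S S′} → (∀ a → S a ≡ S′ a) → ¬ Nonempty S → ¬ Nonempty S′
    Empty-resp S≗S′ S-empty = S-empty ∘ Nonempty-resp (sym ∘ S≗S′)
    empty⊆∅ : ∀ {S} → S Rows.∈ᵛ filter (∁? nonempty?) subsets → S Rows.∈ᵛ (∅ ∷ [])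
    empty⊆∅ S∈ with ∈-filter⁻ subsets-setoid (∁? nonempty?) Empty-resp {xs = subsets} S∈
    ... | _ , S-empty = here λ a → ¬T⇒≡false λ Sa → S-empty (a , Sa)
    ∅⊆empty : ∀ {S} → S Rows.∈ᵛ (∅ ∷ []) → S Rows.∈ᵛ filter (∁? nonempty?) subsets
    ∅⊆empty (here S≗∅) = ∈-filter⁺ subsets-setoid (∁? nonempty?) Empty-resp
      (Rows.allFuns-complete bools-complete m _) λ (a , Sa) → subst T (S≗∅ a) Sa

  posets-congruence : + k ℤ.∣ + e k m - + length fixedPosets
  posets-congruence = length≡length-fixed-mod-k k-prime posets-unique posets-closed

  length-fixed-posets+1 : length fixedPosets + 1 ≡ 2 ℕ.^ m
  length-fixed-posets+1 = begin
    length fixedPosets + 1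
      ≡⟨ cong₂ _+_ length-fixed-posets (sym length-empty-subsets) ⟩
    length (filter nonempty? subsets) + length (filter (∁? nonempty?) subsets)
      ≡⟨ length-filter+filter-∁ nonempty? subsets ⟩
    length subsets
      ≡⟨ Rows.length-allFuns bools m ⟩
    2 ℕ.^ m ∎
    where open ≡-Reasoning

[-1]^n+1≡0⊎2∣n : ∀ n → (- + 1) ^ n ℤ.+ + 1 ≡ + 0 ⊎ 2 ℕ.∣ n
[-1]^n+1≡0⊎2∣n 0 = inj₂ (ℕ.divides 0 refl)
[-1]^n+1≡0⊎2∣n 1 = inj₁ refl
[-1]^n+1≡0⊎2∣n (suc (suc n)) =
  Sum.map (trans (cong (ℤ._+ + 1) [-1]^[2+n]≡[-1]^n)) (ℕ.∣m∣n⇒∣m+n ℕ.∣-refl) ([-1]^n+1≡0⊎2∣n n)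
  where
  [-1]^[2+n]≡[-1]^n : (- + 1) ^ suc (suc n) ≡ (- + 1) ^ n
  [-1]^[2+n]≡[-1]^n = trans (cong (- + 1 ℤ.*_) (ℤ.-1*i≡-i _)) (trans (ℤ.-1*i≡-i _) (ℤ.neg-involutive _))

prime∣[-1]^p+1 : ∀ {p} → Prime p → + p ℤ.∣ (- + 1) ^ p ℤ.+ + 1
prime∣[-1]^p+1 {p} p-prime with [-1]^n+1≡0⊎2∣n p
... | inj₁ [-1]^p+1≡0 = subst (+ p ℤ.∣_) (sym [-1]^p+1≡0) (ℤ.∣ᵤ⇒∣ (p ℕ.∣0))
... | inj₂ 2∣p with prime⇒irreducible p-prime 2∣p
...   | inj₂ refl = ℤ.∣-refl

rearrangement : ∀ x P F s → ((x - F) - (P - (F ℤ.+ + 1))) - (s ℤ.+ + 1) ≡ (x - P) - s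
rearrangement = solve-∀

theorem6p6 : (k m : ℕ) → Prime k → NonZero m →
    (+ k) ∣ ((+ e k m - + (2 Data.Nat.^ (m * k))) - (- (+ 1)) ^ k)
theorem6p6 k m k-prime _ = ℤ.∣⇒∣ᵤ (subst (+ k ℤ.∣_)
  (rearrangement (+ e k m) (+ 2 ℕ.^ (m * k)) (+ length fixedPosets) ((- + 1) ^ k))
  (ℤ.∣m∣n⇒∣m-n (ℤ.∣m∣n⇒∣m-n posets-congruence powers-congruence) (prime∣[-1]^p+1 k-prime)))
  where
  open PosetCount k-prime m
  powers-congruence : + k ℤ.∣ + 2 ℕ.^ (m * k) - (+ length fixedPosets ℤ.+ + 1)
  powers-congruence = subst₂ (λ x y → + k ℤ.∣ + x - y) (^-*-assoc 2 m k)
    (trans (cong +_ (sym length-fixed-posets+1)) (ℤ.pos-+ _ 1)) (fermat k-prime (2 ℕ.^ m))
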